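{- For every positive integer $n$, the directed endomorphism graph $\overrightarrow{\mathrm{Endo}}(\mathbb{Z}_n)$ and the directed power graph $\overrightarrow{\mathrm{Pow}}(\mathbb{Z}_n)$ of the additive group $\mathbb{Z}_n$ are isomorphic.
   Context: For a finite group $G$, $\overrightarrow{\mathrm{Endo}}(G)$ is the directed graph with vertex set $G$ and an arc from $a$ to $b$ ($a \neq b$) iff some group endomorphism $f$ of $G$ satisfies $f(a)=b$. The directed power graph $\overrightarrow{\mathrm{Pow}}(G)$ has vertex set $G$ and an arc from $x$ to $y$ ($x \neq y$) iff $y = x^m$ for some $m \in \mathbb{N}$ (in additive notation, $y = m x$). Both are taken without loops or multiple arcs. $\mathbb{Z}_n$ is the cyclic group of integers modulo $n$ under addition. -}

module Defs where

open import Data.Nat using (ℕ; suc; _+_; _*_)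
open import Data.Nat.DivMod using (_mod_)
open import Data.Fin using (Fin; toℕ)
open import Data.Product using (Σ; _×_)
open import Relation.Binary.PropositionalEquality using (_≡_)
open import Relation.Nullary using (¬_)
open import Function.Bundles using (_⤖_; _⇔_; Bijection)

_+ℤ_ : {k : ℕ} → Fin (suc k) → Fin (suc k) → Fin (suc k)
_+ℤ_ {k} a b = (toℕ a + toℕ b) mod (suc k)

-- m · x in ℤ_n (m-fold sum of x)
_·ℤ_ : {k : ℕ} → ℕ → Fin (suc k) → Fin (suc k)
_·ℤ_ {k} m x = (m * toℕ x) mod (suc k)

-- Group endomorphisms of ℤ_n (a map preserving addition; this already
-- forces preservation of identity and inverses in a group).
IsEndo : {k : ℕ} → (Fin (suc k) → Fin (suc k)) → Set
IsEndo {k} f = ∀ a b → f (a +ℤ b) ≡ f a +ℤ f b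

EndoArc : {k : ℕ} → Fin (suc k) → Fin (suc k) → Set
EndoArc {k} a b = ¬ (a ≡ b) × Σ (Fin (suc k) → Fin (suc k)) (λ f → IsEndo f × f a ≡ b)

PowArc : {k : ℕ} → Fin (suc k) → Fin (suc k) → Set
PowArc {k} x y = ¬ (x ≡ y) × Σ ℕ (λ m → y ≡ m ·ℤ x)

DigraphIso : {V : Set} → (V → V → Set) → (V → V → Set) → Set
DigraphIso {V} E₁ E₂ =
  Σ (V ⤖ V) (λ φ → ∀ a b → E₁ a b ⇔ E₂ (Bijection.to φ a) (Bijection.to φ b))

{-# OPTIONS --safe #-}
-- An additive map f on ℤₙ satisfies f (m mod n) = m · f 1: by induction for m ≥ 1,
-- and for m = 0 by replacing m with m + n. So f is the scaling by toℕ (f 1), while every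
-- scaling is additive; hence Endo(ℤₙ) and Pow(ℤₙ) have the same arcs.
module Submission where

open import Defs
open import Data.Nat using (ℕ; suc; _+_; _*_; _%_)
open import Data.Nat.Properties using (*-comm; *-identityˡ; *-distribʳ-+; *-distribˡ-+; +-suc)
open import Data.Nat.DivMod
  using (_mod_; m%n<n; m<n⇒m%n≡m; [m+n]%n≡m%n; [m+kn]%n≡m%n; %-distribˡ-+; %-distribˡ-*; m%n%n≡m%n)
open import Data.Fin using (Fin; toℕ)
open import Data.Fin.Properties using (toℕ-injective; toℕ-fromℕ<; toℕ<n)
open import Data.Product using (_,_)
open import Relation.Binary.PropositionalEquality using (_≡_; sym; trans; cong; cong₂; module ≡-Reasoning)
open import Function.Bundles using (_⇔_; mk⇔)
open import Function.Construct.Identity using (⤖-id)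

module _ (k : ℕ) where
  private
    n : ℕ
    n = suc k

  toℕ-mod : ∀ m → toℕ (m mod n) ≡ m % n
  toℕ-mod m = toℕ-fromℕ< (m%n<n m n)

  %-≡⇒mod-≡ : ∀ m m′ → m % n ≡ m′ % n → m mod n ≡ m′ mod n
  %-≡⇒mod-≡ m m′ eq = toℕ-injective (trans (toℕ-mod m) (trans eq (sym (toℕ-mod m′))))

  mod-toℕ : (a : Fin n) → toℕ a mod n ≡ a
  mod-toℕ a = toℕ-injective (trans (toℕ-mod (toℕ a)) (m<n⇒m%n≡m (toℕ<n a)))

  mod-periodic : ∀ m → (m + n) mod n ≡ m mod n
  mod-periodic m = %-≡⇒mod-≡ (m + n) m ([m+n]%n≡m%n m n)

  mod-homo-+ : ∀ a b → (a mod n) +ℤ (b mod n) ≡ (a + b) mod n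
  mod-homo-+ a b = %-≡⇒mod-≡ (toℕ (a mod n) + toℕ (b mod n)) (a + b) (begin
    (toℕ (a mod n) + toℕ (b mod n)) % n ≡⟨ cong₂ (λ x y → (x + y) % n) (toℕ-mod a) (toℕ-mod b) ⟩
    (a % n + b % n) % n                 ≡⟨ sym (%-distribˡ-+ a b n) ⟩
    (a + b) % n                         ∎)
    where open ≡-Reasoning

  ·ℤ-mod : ∀ m a → m ·ℤ (a mod n) ≡ (m * a) mod n
  ·ℤ-mod m a = %-≡⇒mod-≡ (m * toℕ (a mod n)) (m * a) (begin
    (m * toℕ (a mod n)) % n    ≡⟨ cong (λ t → (m * t) % n) (toℕ-mod a) ⟩
    (m * (a % n)) % n          ≡⟨ %-distribˡ-* m (a % n) n ⟩
    (m % n * (a % n % n)) % n  ≡⟨ cong (λ t → (m % n * t) % n) (m%n%n≡m%n a n) ⟩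
    (m % n * (a % n)) % n      ≡⟨ sym (%-distribˡ-* m a n) ⟩
    (m * a) % n                ∎)
    where open ≡-Reasoning

  ·ℤ-periodic : ∀ m (x : Fin n) → (m + n) ·ℤ x ≡ m ·ℤ x
  ·ℤ-periodic m x = %-≡⇒mod-≡ ((m + n) * toℕ x) (m * toℕ x) (begin
    ((m + n) * toℕ x) % n          ≡⟨ cong (_% n) (*-distribʳ-+ (toℕ x) m n) ⟩
    (m * toℕ x + n * toℕ x) % n    ≡⟨ cong (λ t → (m * toℕ x + t) % n) (*-comm n (toℕ x)) ⟩
    (m * toℕ x + toℕ x * n) % n    ≡⟨ [m+kn]%n≡m%n (m * toℕ x) (toℕ x) n ⟩
    (m * toℕ x) % n                ∎)
    where open ≡-Reasoning

  ·ℤ-isEndo : ∀ m → IsEndo {k} (m ·ℤ_)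
  ·ℤ-isEndo m a b = begin
    m ·ℤ ((toℕ a + toℕ b) mod n)                   ≡⟨ ·ℤ-mod m (toℕ a + toℕ b) ⟩
    (m * (toℕ a + toℕ b)) mod n                    ≡⟨ cong (_mod n) (*-distribˡ-+ m (toℕ a) (toℕ b)) ⟩
    (m * toℕ a + m * toℕ b) mod n                  ≡⟨ sym (mod-homo-+ (m * toℕ a) (m * toℕ b)) ⟩
    ((m * toℕ a) mod n) +ℤ ((m * toℕ b) mod n)     ∎
    where open ≡-Reasoning

  module _ {f : Fin n → Fin n} (endo : IsEndo f) where
    endo-suc-mod : ∀ m → f (suc m mod n) ≡ suc m ·ℤ f (1 mod n)
    endo-suc-mod 0 = begin
      e                    ≡⟨ sym (mod-toℕ e) ⟩
      toℕ e mod n          ≡⟨ cong (_mod n) (sym (*-identityˡ (toℕ e))) ⟩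
      (1 * toℕ e) mod n    ∎
      where open ≡-Reasoning
            e = f (1 mod n)
    endo-suc-mod (suc m) = begin
      f ((1 + suc m) mod n)            ≡⟨ cong f (sym (mod-homo-+ 1 (suc m))) ⟩
      f ((1 mod n) +ℤ (suc m mod n))   ≡⟨ endo (1 mod n) (suc m mod n) ⟩
      e +ℤ f (suc m mod n)             ≡⟨ cong₂ _+ℤ_ (sym (mod-toℕ e)) (endo-suc-mod m) ⟩
      (toℕ e mod n) +ℤ (suc m ·ℤ e)    ≡⟨ mod-homo-+ (toℕ e) (suc m * toℕ e) ⟩
      (toℕ e + suc m * toℕ e) mod n    ∎
      where open ≡-Reasoning
            e = f (1 mod n)

    endo-mod : ∀ m → f (m mod n) ≡ m ·ℤ f (1 mod n)
    endo-mod m = begin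
      f (m mod n)                   ≡⟨ cong f (sym (mod-periodic m)) ⟩
      f ((m + n) mod n)             ≡⟨ cong (λ t → f (t mod n)) (+-suc m k) ⟩
      f (suc (m + k) mod n)         ≡⟨ endo-suc-mod (m + k) ⟩
      suc (m + k) ·ℤ f (1 mod n)    ≡⟨ cong (_·ℤ f (1 mod n)) (sym (+-suc m k)) ⟩
      (m + n) ·ℤ f (1 mod n)        ≡⟨ ·ℤ-periodic m (f (1 mod n)) ⟩
      m ·ℤ f (1 mod n)              ∎
      where open ≡-Reasoning

    endo≗·ℤ : ∀ a → f a ≡ toℕ (f (1 mod n)) ·ℤ a
    endo≗·ℤ a = begin
      f a                               ≡⟨ cong f (sym (mod-toℕ a)) ⟩
      f (toℕ a mod n)                   ≡⟨ endo-mod (toℕ a) ⟩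
      (toℕ a * toℕ (f (1 mod n))) mod n ≡⟨ cong (_mod n) (*-comm (toℕ a) (toℕ (f (1 mod n)))) ⟩
      toℕ (f (1 mod n)) ·ℤ a            ∎
      where open ≡-Reasoning

  endoArc⇔powArc : (a b : Fin n) → EndoArc a b ⇔ PowArc a b
  endoArc⇔powArc a b = mk⇔
    (λ (a≢b , f , endo , fa≡b) → a≢b , toℕ (f (1 mod n)) , trans (sym fa≡b) (endo≗·ℤ {f} endo a))
    (λ (a≢b , m , b≡ma) → a≢b , m ·ℤ_ , ·ℤ-isEndo m , sym b≡ma)

theorem2p4 : (k : ℕ) → DigraphIso {Fin (suc k)} EndoArc PowArc
theorem2p4 k = ⤖-id _ , endoArc⇔powArc k
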